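{- Let $p$ be a positive integer. For $n\ge 0$, let $\mathcal{B}^{(p)}_n$ denote the set of $p$-Fibonacci polyominoes with $n$ columns (with $\mathcal{B}^{(p)}_0$ consisting only of the empty polyomino), and define \[F_p(x;y,z)=\sum_{n\ge 0}x^n\sum_{P\in\mathcal{B}^{(p)}_n} y^{\mathrm{area}(P)}z^{\mathrm{sper}(P)}.\] Then \[F_p(x;y,z)=1+\frac{\sum_{i=1}^{p}x^{p-i+1}y^{\frac12(p+i)(p-i+1)}z^{2p-i+1}}{1-xy^pz-\sum_{i=1}^{p-1}x^{p-i+1}y^{\frac12(p+i)(p-i+1)}z^{2p-2i+1}}.\]
   Context: A $p$-Fibonacci word of length $n\ge 1$ is a word $u=u_1u_2\cdots u_n$ over $\{1,\dots,p\}$ with $u_1=p$ and, for $1\le i\le n-1$: if $u_i=1$ then $u_{i+1}=p$; if $2\le u_i\le p$ then $u_{i+1}\in\{u_i-1,\,p\}$. The empty word is the unique $p$-Fibonacci word of length $0$. Each $p$-Fibonacci word $u=u_1\cdots u_n$ determines a polyomino (bargraph) with $n$ columns: a sequence of $n$ adjacent columns of unit square cells, all resting on a common horizontal base line, where the $i$-th column consists of $u_i$ cells stacked vertically; these are the $p$-Fibonacci polyominoes. For such a polyomino $P$, $\mathrm{area}(P)$ is the number of cells of $P$ and $\mathrm{sper}(P)$ is half the length of the perimeter (boundary) of $P$. The empty polyomino has area $0$ and semi-perimeter $0$. -}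

module Defs where

open import Data.Nat using (ℕ; zero; suc; _+_; _*_; _∸_; _≤ᵇ_; _≡ᵇ_; _/_)
open import Data.Bool using (Bool; true; false; _∧_; _∨_; not; if_then_else_)
open import Data.List using (List; []; _∷_; map; concatMap; upTo)
open import Data.Integer as ℤ using (ℤ; +_)

letters : ℕ → List ℕ
letters p = map suc (upTo p)

allWords : ℕ → ℕ → List (List ℕ)
allWords p zero    = [] ∷ []
allWords p (suc n) = concatMap (λ w → map (λ c → c ∷ w) (letters p)) (allWords p n)

step : ℕ → ℕ → ℕ → Bool
step p u v = if u ≡ᵇ 1 then v ≡ᵇ p else ((v ≡ᵇ u ∸ 1) ∨ (v ≡ᵇ p))

validSteps : ℕ → List ℕ → Bool
validSteps p (u ∷ v ∷ rest) = step p u v ∧ validSteps p (v ∷ rest)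
validSteps p _              = true

-- u is a p-Fibonacci word (given that its letters lie in {1..p});
-- the empty word is p-Fibonacci
isPFib : ℕ → List ℕ → Bool
isPFib p []       = true
isPFib p (u ∷ us) = (u ≡ᵇ p) ∧ validSteps p (u ∷ us)

-- The bargraph polyomino of a word: columns 1..n, column i has cells
-- (i , j) for 1 ≤ j ≤ u_i.

-- height of column i (1-based); 0 outside the columns 1..n
hgt : List ℕ → ℕ → ℕ
hgt w        zero          = 0
hgt []       (suc i)       = 0
hgt (u ∷ us) (suc zero)    = u
hgt (u ∷ us) (suc (suc i)) = hgt us (suc i)

isCell : List ℕ → ℕ → ℕ → Bool
isCell w i j = (1 ≤ᵇ i) ∧ (1 ≤ᵇ j) ∧ (j ≤ᵇ hgt w i)

b2n : Bool → ℕ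
b2n true  = 1
b2n false = 0

sumℕ : ℕ → (ℕ → ℕ) → ℕ
sumℕ zero    f = 0
sumℕ (suc m) f = sumℕ m f + f (suc m)

len : List ℕ → ℕ
len []       = 0
len (_ ∷ us) = suc (len us)

area : List ℕ → ℕ
area []       = 0
area (u ∷ us) = u + area us

freeSides : List ℕ → ℕ → ℕ → ℕ
freeSides w i j =
  b2n (not (isCell w (i ∸ 1) j)) + b2n (not (isCell w (suc i) j))
  + b2n (not (isCell w i (j ∸ 1))) + b2n (not (isCell w i (suc j)))

perimeter : List ℕ → ℕ
perimeter w = sumℕ (len w) (λ i → sumℕ (hgt w i) (λ j → freeSides w i j))

sper : List ℕ → ℕ
sper w = perimeter w / 2

-- Formal power series in x , y , z with integer coefficients:
-- S n a s is the coefficient of x^n y^a z^s.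

Ser : Set
Ser = ℕ → ℕ → ℕ → ℤ

sumℤ0 : ℕ → (ℕ → ℤ) → ℤ
sumℤ0 zero    f = f 0
sumℤ0 (suc m) f = sumℤ0 m f ℤ.+ f (suc m)

_⊕_ : Ser → Ser → Ser
(f ⊕ g) n a s = f n a s ℤ.+ g n a s

_⊖_ : Ser → Ser → Ser
(f ⊖ g) n a s = f n a s ℤ.- g n a s

_⊛_ : Ser → Ser → Ser
(f ⊛ g) n a s =
  sumℤ0 n (λ i → sumℤ0 a (λ j → sumℤ0 s (λ k →
    f i j k ℤ.* g (n ∸ i) (a ∸ j) (s ∸ k))))

mono : ℕ → ℕ → ℕ → Ser
mono e1 e2 e3 n a s =
  if (n ≡ᵇ e1) ∧ (a ≡ᵇ e2) ∧ (s ≡ᵇ e3) then + 1 else + 0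

one : Ser
one = mono 0 0 0

sumSer : ℕ → (ℕ → Ser) → Ser
sumSer zero    f = λ _ _ _ → + 0
sumSer (suc m) f = sumSer m f ⊕ f (suc m)

count : (List ℕ → Bool) → List (List ℕ) → ℕ
count P []       = 0
count P (w ∷ ws) = b2n (P w) + count P ws

Fcoef : ℕ → ℕ → ℕ → ℕ → ℕ
Fcoef p n a s =
  count (λ w → isPFib p w ∧ (area w ≡ᵇ a) ∧ (sper w ≡ᵇ s)) (allWords p n)

F : ℕ → Ser
F p n a s = + Fcoef p n a s

ex : ℕ → ℕ → ℕ
ex p i = ((p + i) * (p ∸ i + 1)) / 2

Num : ℕ → Ser
Num p = sumSer p (λ i → mono (p ∸ i + 1) (ex p i) (2 * p ∸ i + 1))

Den : ℕ → Ser
Den p = (one ⊖ mono 1 p 1)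
      ⊖ sumSer (p ∸ 1) (λ i → mono (p ∸ i + 1) (ex p i) (2 * p ∸ 2 * i + 1))

-- Prefixing a letter c to a word starting with
-- d adds c to the area and 1 + (c ∸ d) to the semi-perimeter, because the
-- semi-perimeter of a bargraph is its number of columns plus its total descent.
-- After c ≥ 2 comes c − 1 or p, after 1 only p, so a word starting with p runs
-- down p, p − 1, …, i and then either ends, contributing
-- x^(p−i+1) y^((p+i)(p−i+1)/2) z^(2p−i+1), or jumps back to p, contributing
-- x^(p−i+1) y^((p+i)(p−i+1)/2) z^(2p−2i+1) times the series G of nonempty words
-- again. The term i = p of the latter is x y^p z, so G = Num + (1 − Den) G, and
-- F = 1 + G gives F · Den = Den + Num.

module Submission where

open import Defs
open import Data.Nat using (ℕ; _≤_)
open import Relation.Binary.PropositionalEquality using (_≡_)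

import Algebra.Properties.CommutativeSemigroup as CommutativeSemigroupProperties
open import Data.Bool using (Bool; true; false; _∧_; _∨_; not; if_then_else_; T)
open import Data.Bool.Properties using (∧-assoc; ∧-zeroʳ; if-∧)
open import Data.Empty using (⊥-elim)
open import Data.Integer as ℤ using (ℤ; +_)
import Data.Integer.Properties as ℤ
import Data.Integer.Tactic.RingSolver as ℤ-Solver
open import Data.List using (List; []; _∷_; map; concatMap; _++_; _∷ʳ_; upTo)
open import Data.List.Properties using (map-cong; map-++; upTo-∷ʳ)
open import Data.Nat using (zero; suc; _+_; _*_; _∸_; _/_; _<_; _≤ᵇ_; _<ᵇ_; _≡ᵇ_; z≤n; s≤s)
open import Data.Nat.DivMod using (m*n/n≡m)
open import Data.Nat.ListAction using (sum)
open import Data.Nat.ListAction.Properties using (sum-++)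
open import Data.Nat.Properties
open import Data.Nat.Tactic.RingSolver using (solve-∀)
open import Data.Sum using (_⊎_; inj₁; inj₂)
open import Function using (_∘_)
open import Level using (0ℓ)
open import Relation.Binary.Bundles using (Setoid)
import Relation.Binary.Reasoning.Setoid as SetoidReasoning
open import Relation.Nullary using (yes; no)
open import Relation.Binary.PropositionalEquality
  using (refl; sym; trans; cong; cong₂; subst; _≢_; _≗_; module ≡-Reasoning)

module ℕ-+ = CommutativeSemigroupProperties +-commutativeSemigroup
module ℤ-+ = CommutativeSemigroupProperties ℤ.+-commutativeSemigroup

<ᵇ-true : ∀ {m n} → m < n → (m <ᵇ n) ≡ true
<ᵇ-true (s≤s z≤n)       = refl
<ᵇ-true (s≤s (s≤s m<n)) = <ᵇ-true (s≤s m<n)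

<ᵇ-false : ∀ {m n} → n ≤ m → (m <ᵇ n) ≡ false
<ᵇ-false z≤n       = refl
<ᵇ-false (s≤s n≤m) = <ᵇ-false n≤m

≡ᵇ-refl : ∀ n → (n ≡ᵇ n) ≡ true
≡ᵇ-refl zero    = refl
≡ᵇ-refl (suc n) = ≡ᵇ-refl n

≡ᵇ-false : ∀ {m n} → m ≢ n → (m ≡ᵇ n) ≡ false
≡ᵇ-false {m} {n} m≢n with m ≡ᵇ n in eq
... | false = refl
... | true  = ⊥-elim (m≢n (≡ᵇ⇒≡ m n (subst T (sym eq) _)))

≡ᵇ-sym : ∀ m n → (m ≡ᵇ n) ≡ (n ≡ᵇ m)
≡ᵇ-sym zero    zero    = refl
≡ᵇ-sym zero    (suc n) = refl
≡ᵇ-sym (suc m) zero    = refl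
≡ᵇ-sym (suc m) (suc n) = ≡ᵇ-sym m n

-- Delayed sequences

module _ {A : Set} (z : A) where

  delay : ℕ → (ℕ → A) → ℕ → A
  delay zero    g n       = g n
  delay (suc e) g zero    = z
  delay (suc e) g (suc n) = delay e g n

  delay-const : ∀ e n → delay e (λ _ → z) n ≡ z
  delay-const zero    n       = refl
  delay-const (suc e) zero    = refl
  delay-const (suc e) (suc n) = delay-const e n

  delay-cong : ∀ e {f g} → f ≗ g → delay e f ≗ delay e g
  delay-cong zero    f≗g n       = f≗g n
  delay-cong (suc e) f≗g zero    = refl
  delay-cong (suc e) f≗g (suc n) = delay-cong e f≗g n

  delay-delay : ∀ e d g → delay e (delay d g) ≗ delay (e + d) g
  delay-delay zero    d g n       = refl
  delay-delay (suc e) d g zero    = refl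
  delay-delay (suc e) d g (suc n) = delay-delay e d g n

  delay-comm : ∀ e d (g : ℕ → ℕ → A) m n →
    delay e (λ x → delay d (g x) n) m ≡ delay d (λ y → delay e (λ x → g x y) m) n
  delay-comm zero    d g m       n = refl
  delay-comm (suc e) d g zero    n = sym (delay-const d n)
  delay-comm (suc e) d g (suc m) n = delay-comm e d g m n

  delay-zipWith : (_∙_ : A → A → A) → z ∙ z ≡ z →
    ∀ e f g n → delay e (λ x → f x ∙ g x) n ≡ delay e f n ∙ delay e g n
  delay-zipWith _∙_ z∙z zero    f g n       = refl
  delay-zipWith _∙_ z∙z (suc e) f g zero    = sym z∙z
  delay-zipWith _∙_ z∙z (suc e) f g (suc n) = delay-zipWith _∙_ z∙z e f g n

  delay-if : ∀ b e g n →
    delay e (λ x → if b then g x else z) n ≡ (if b then delay e g n else z)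
  delay-if true  e g n = refl
  delay-if false e g n = delay-const e n

  delay-indicator : ∀ e t v n →
    delay e (λ x → if x ≡ᵇ t then v else z) n ≡ (if n ≡ᵇ e + t then v else z)
  delay-indicator zero    t v n       = refl
  delay-indicator (suc e) t v zero    = refl
  delay-indicator (suc e) t v (suc n) = delay-indicator e t v n

delay-map : ∀ {A B : Set} {z : A} {z′ : B} (h : A → B) → h z ≡ z′ →
  ∀ e g n → h (delay z e g n) ≡ delay z′ e (h ∘ g) n
delay-map h hz zero    g n       = refl
delay-map h hz (suc e) g zero    = hz
delay-map h hz (suc e) g (suc n) = delay-map h hz e g n

when : Bool → ℤ → ℤ
when b x = if b then x else + 0

sumℤ0-cong : ∀ m {f g : ℕ → ℤ} → f ≗ g → sumℤ0 m f ≡ sumℤ0 m g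
sumℤ0-cong zero    f≗g = f≗g 0
sumℤ0-cong (suc m) f≗g = cong₂ ℤ._+_ (sumℤ0-cong m f≗g) (f≗g (suc m))

sumℤ0-zero : ∀ m → sumℤ0 m (λ _ → + 0) ≡ + 0
sumℤ0-zero zero    = refl
sumℤ0-zero (suc m) = cong (ℤ._+ + 0) (sumℤ0-zero m)

sumℤ0-if : ∀ m b g → sumℤ0 m (λ i → when b (g i)) ≡ when b (sumℤ0 m g)
sumℤ0-if m true  g = refl
sumℤ0-if m false g = sumℤ0-zero m

sumℤ0-+ : ∀ m f g → sumℤ0 m (λ i → f i ℤ.+ g i) ≡ sumℤ0 m f ℤ.+ sumℤ0 m g
sumℤ0-+ zero    f g = refl
sumℤ0-+ (suc m) f g =
  trans (cong (ℤ._+ (f (suc m) ℤ.+ g (suc m))) (sumℤ0-+ m f g))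
        (ℤ-+.interchange (sumℤ0 m f) (sumℤ0 m g) (f (suc m)) (g (suc m)))

sumℤ0-- : ∀ m f g → sumℤ0 m (λ i → f i ℤ.- g i) ≡ sumℤ0 m f ℤ.- sumℤ0 m g
sumℤ0-- zero    f g = refl
sumℤ0-- (suc m) f g =
  trans (cong (ℤ._+ (f (suc m) ℤ.- g (suc m))) (sumℤ0-- m f g))
        (-‿+-interchange (sumℤ0 m f) (sumℤ0 m g) (f (suc m)) (g (suc m)))
  where
  -‿+-interchange : ∀ a b c d → (a ℤ.- b) ℤ.+ (c ℤ.- d) ≡ (a ℤ.+ c) ℤ.- (b ℤ.+ d)
  -‿+-interchange = ℤ-Solver.solve-∀

sumℤ0-suc : ∀ m f → sumℤ0 (suc m) f ≡ f 0 ℤ.+ sumℤ0 m (f ∘ suc)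
sumℤ0-suc zero    f = refl
sumℤ0-suc (suc m) f = trans (cong (ℤ._+ f (suc (suc m))) (sumℤ0-suc m f)) (ℤ.+-assoc (f 0) _ _)

sumℤ0-delta : ∀ n e g → sumℤ0 n (λ i → when (n ∸ i ≡ᵇ e) (g i)) ≡ delay (+ 0) e g n
sumℤ0-delta zero    zero    g = refl
sumℤ0-delta zero    (suc e) g = refl
sumℤ0-delta (suc n) e g = begin
  sumℤ0 (suc n) (λ i → when (suc n ∸ i ≡ᵇ e) (g i))
    ≡⟨ sumℤ0-suc n _ ⟩
  when (suc n ≡ᵇ e) (g 0) ℤ.+ sumℤ0 n (λ i → when (n ∸ i ≡ᵇ e) (g (suc i)))
    ≡⟨ cong (λ t → when (suc n ≡ᵇ e) (g 0) ℤ.+ t) (sumℤ0-delta n e (g ∘ suc)) ⟩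
  when (suc n ≡ᵇ e) (g 0) ℤ.+ delay (+ 0) e (g ∘ suc) n
    ≡⟨ head-+-delay-suc e n ⟩
  delay (+ 0) e g (suc n) ∎
  where
  open ≡-Reasoning
  head-+-delay-suc : ∀ e n →
    when (suc n ≡ᵇ e) (g 0) ℤ.+ delay (+ 0) e (g ∘ suc) n ≡ delay (+ 0) e g (suc n)
  head-+-delay-suc zero          n       = ℤ.+-identityˡ _
  head-+-delay-suc (suc zero)    zero    = ℤ.+-identityʳ (g 0)
  head-+-delay-suc (suc (suc e)) zero    = refl
  head-+-delay-suc (suc e)       (suc n) = head-+-delay-suc e n

sumℕ-cong : ∀ m {f g : ℕ → ℕ} → (∀ k → 1 ≤ k → k ≤ m → f k ≡ g k) → sumℕ m f ≡ sumℕ m g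
sumℕ-cong zero    f≡g = refl
sumℕ-cong (suc m) f≡g =
  cong₂ _+_ (sumℕ-cong m (λ k 1≤k k≤m → f≡g k 1≤k (m≤n⇒m≤1+n k≤m))) (f≡g (suc m) (s≤s z≤n) ≤-refl)

sumℕ-+ : ∀ m f g → sumℕ m (λ k → f k + g k) ≡ sumℕ m f + sumℕ m g
sumℕ-+ zero    f g = refl
sumℕ-+ (suc m) f g =
  trans (cong (_+ (f (suc m) + g (suc m))) (sumℕ-+ m f g))
        (ℕ-+.interchange (sumℕ m f) (sumℕ m g) (f (suc m)) (g (suc m)))

sumℕ-zero : ∀ m → sumℕ m (λ _ → 0) ≡ 0
sumℕ-zero zero    = refl
sumℕ-zero (suc m) = cong (_+ 0) (sumℕ-zero m)

sumℕ-suc : ∀ m f → sumℕ (suc m) f ≡ f 1 + sumℕ m (f ∘ suc)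
sumℕ-suc zero    f = +-comm 0 (f 1)
sumℕ-suc (suc m) f = trans (cong (_+ f (suc (suc m))) (sumℕ-suc m f)) (+-assoc (f 1) _ _)

sum-map-+ : ∀ {A : Set} (f g : A → ℕ) xs →
  sum (map (λ x → f x + g x) xs) ≡ sum (map f xs) + sum (map g xs)
sum-map-+ f g []       = refl
sum-map-+ f g (x ∷ xs) =
  trans (cong (λ t → f x + g x + t) (sum-map-+ f g xs))
        (ℕ-+.interchange (f x) (g x) (sum (map f xs)) (sum (map g xs)))

sum-map-zero : ∀ {A : Set} (xs : List A) → sum (map (λ _ → 0) xs) ≡ 0
sum-map-zero []       = refl
sum-map-zero (x ∷ xs) = sum-map-zero xs

-- Formal power series

0ₛ : Ser
0ₛ _ _ _ = + 0

infix 4 _≈_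
_≈_ : Ser → Ser → Set
f ≈ g = ∀ n a s → f n a s ≡ g n a s

≈-refl : ∀ {f} → f ≈ f
≈-refl n a s = refl

≈-sym : ∀ {f g} → f ≈ g → g ≈ f
≈-sym f≈g n a s = sym (f≈g n a s)

≈-trans : ∀ {f g h} → f ≈ g → g ≈ h → f ≈ h
≈-trans f≈g g≈h n a s = trans (f≈g n a s) (g≈h n a s)

≈-setoid : Setoid 0ℓ 0ℓ
≈-setoid = record
  { Carrier = Ser ; _≈_ = _≈_
  ; isEquivalence = record { refl = ≈-refl ; sym = ≈-sym ; trans = ≈-trans } }

module ≈-Reasoning = SetoidReasoning ≈-setoid

⊕-cong : ∀ {f f′ g g′} → f ≈ f′ → g ≈ g′ → f ⊕ g ≈ f′ ⊕ g′
⊕-cong f≈f′ g≈g′ n a s = cong₂ ℤ._+_ (f≈f′ n a s) (g≈g′ n a s)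

⊕-rotate : ∀ f g h → (f ⊕ g) ⊕ h ≈ g ⊕ (f ⊕ h)
⊕-rotate f g h n a s = rotate (f n a s) (g n a s) (h n a s)
  where
  rotate : ∀ x y z → (x ℤ.+ y) ℤ.+ z ≡ y ℤ.+ (x ℤ.+ z)
  rotate = ℤ-Solver.solve-∀

sumSer-cong : ∀ m {f g : ℕ → Ser} → (∀ i → 1 ≤ i → i ≤ m → f i ≈ g i) → sumSer m f ≈ sumSer m g
sumSer-cong zero    f≈g = ≈-refl
sumSer-cong (suc m) f≈g =
  ⊕-cong (sumSer-cong m (λ i 1≤i i≤m → f≈g i 1≤i (m≤n⇒m≤1+n i≤m))) (f≈g (suc m) (s≤s z≤n) ≤-refl)

sumSer-⊕ : ∀ m f g → sumSer m (λ i → f i ⊕ g i) ≈ sumSer m f ⊕ sumSer m g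
sumSer-⊕ zero    f g n a s = refl
sumSer-⊕ (suc m) f g n a s =
  trans (cong (ℤ._+ (f (suc m) n a s ℤ.+ g (suc m) n a s)) (sumSer-⊕ m f g n a s))
        (ℤ-+.interchange (sumSer m f n a s) (sumSer m g n a s) (f (suc m) n a s) (g (suc m) n a s))

mono-nested : ∀ e₁ e₂ e₃ n a s →
  mono e₁ e₂ e₃ n a s ≡ when (n ≡ᵇ e₁) (when (a ≡ᵇ e₂) (when (s ≡ᵇ e₃) (+ 1)))
mono-nested e₁ e₂ e₃ n a s =
  trans (if-∧ (n ≡ᵇ e₁)) (cong (when (n ≡ᵇ e₁)) (if-∧ (a ≡ᵇ e₂)))

mono-cong : ∀ {e₁ e₂ e₃ d₁ d₂ d₃} → e₁ ≡ d₁ → e₂ ≡ d₂ → e₃ ≡ d₃ → mono e₁ e₂ e₃ ≈ mono d₁ d₂ d₃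
mono-cong refl refl refl = ≈-refl

-- Multiplication by x^e₁ y^e₂ z^e₃, see ⊛-mono.
shift : ℕ → ℕ → ℕ → Ser → Ser
shift e₁ e₂ e₃ f n a s =
  delay (+ 0) e₁ (λ n′ → delay (+ 0) e₂ (λ a′ → delay (+ 0) e₃ (f n′ a′) s) a) n

shift-cong : ∀ e₁ e₂ e₃ {f g} → f ≈ g → shift e₁ e₂ e₃ f ≈ shift e₁ e₂ e₃ g
shift-cong e₁ e₂ e₃ f≈g n a s =
  delay-cong _ e₁ (λ n′ → delay-cong _ e₂ (λ a′ → delay-cong _ e₃ (f≈g n′ a′) s) a) n

shift-exponents : ∀ {e₁ e₂ e₃ d₁ d₂ d₃} f → e₁ ≡ d₁ → e₂ ≡ d₂ → e₃ ≡ d₃ →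
  shift e₁ e₂ e₃ f ≈ shift d₁ d₂ d₃ f
shift-exponents f refl refl refl = ≈-refl

shift-shift : ∀ e₁ e₂ e₃ d₁ d₂ d₃ f →
  shift e₁ e₂ e₃ (shift d₁ d₂ d₃ f) ≈ shift (e₁ + d₁) (e₂ + d₂) (e₃ + d₃) f
shift-shift e₁ e₂ e₃ d₁ d₂ d₃ f n a s =
  trans (delay-cong _ e₁ (λ n′ → trans (delay-cong _ e₂ (λ a′ → pull-z n′ a′) a) (pull-y n′)) n)
        (delay-delay _ e₁ d₁ _ n)
  where
  D = delay (+ 0)
  pull-z : ∀ n′ a′ →
    D e₃ (λ s′ → D d₁ (λ n″ → D d₂ (λ a″ → D d₃ (f n″ a″) s′) a′) n′) s
    ≡ D d₁ (λ n″ → D d₂ (λ a″ → D (e₃ + d₃) (f n″ a″) s) a′) n′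
  pull-z n′ a′ =
    trans (delay-comm _ e₃ d₁ (λ s′ n″ → D d₂ (λ a″ → D d₃ (f n″ a″) s′) a′) s n′)
          (delay-cong _ d₁ (λ n″ →
            trans (delay-comm _ e₃ d₂ (λ s′ a″ → D d₃ (f n″ a″) s′) s a′)
                  (delay-cong _ d₂ (λ a″ → delay-delay _ e₃ d₃ (f n″ a″) s) a′)) n′)
  pull-y : ∀ n′ →
    D e₂ (λ a′ → D d₁ (λ n″ → D d₂ (λ a″ → D (e₃ + d₃) (f n″ a″) s) a′) n′) a
    ≡ D d₁ (λ n″ → D (e₂ + d₂) (λ a″ → D (e₃ + d₃) (f n″ a″) s) a) n′
  pull-y n′ =
    trans (delay-comm _ e₂ d₁ (λ a′ n″ → D d₂ (λ a″ → D (e₃ + d₃) (f n″ a″) s) a′) a n′)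
          (delay-cong _ d₁ (λ n″ → delay-delay _ e₂ d₂ _ a) n′)

shift-⊕ : ∀ e₁ e₂ e₃ f g → shift e₁ e₂ e₃ (f ⊕ g) ≈ shift e₁ e₂ e₃ f ⊕ shift e₁ e₂ e₃ g
shift-⊕ e₁ e₂ e₃ f g n a s =
  trans (delay-cong _ e₁ (λ n′ →
           trans (delay-cong _ e₂ (λ a′ → delay-zipWith _ ℤ._+_ refl e₃ _ _ s) a)
                 (delay-zipWith _ ℤ._+_ refl e₂ _ _ a)) n)
        (delay-zipWith _ ℤ._+_ refl e₁ _ _ n)

shift-0ₛ : ∀ e₁ e₂ e₃ → shift e₁ e₂ e₃ 0ₛ ≈ 0ₛ
shift-0ₛ e₁ e₂ e₃ n a s =
  trans (delay-cong _ e₁ (λ n′ → trans (delay-cong _ e₂ (λ a′ → delay-const _ e₃ s) a)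
                                        (delay-const _ e₂ a)) n)
        (delay-const _ e₁ n)

shift-sumSer : ∀ e₁ e₂ e₃ m g → shift e₁ e₂ e₃ (sumSer m g) ≈ sumSer m (shift e₁ e₂ e₃ ∘ g)
shift-sumSer e₁ e₂ e₃ zero    g = shift-0ₛ e₁ e₂ e₃
shift-sumSer e₁ e₂ e₃ (suc m) g =
  ≈-trans (shift-⊕ e₁ e₂ e₃ _ _) (⊕-cong (shift-sumSer e₁ e₂ e₃ m g) ≈-refl)

shift-mono : ∀ e₁ e₂ e₃ d₁ d₂ d₃ →
  shift e₁ e₂ e₃ (mono d₁ d₂ d₃) ≈ mono (e₁ + d₁) (e₂ + d₂) (e₃ + d₃)
shift-mono e₁ e₂ e₃ d₁ d₂ d₃ n a s =
  trans (delay-cong _ e₁ (λ n′ → trans (delay-cong _ e₂ (along-z n′) a) (along-y n′)) n)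
        (trans (delay-indicator _ e₁ d₁ _ n) (sym (mono-nested _ _ _ n a s)))
  where
  along : ∀ b e t c m →
    delay (+ 0) e (λ x → when b (when (x ≡ᵇ t) c)) m ≡ when b (when (m ≡ᵇ e + t) c)
  along b e t c m = trans (delay-if _ b e _ m) (cong (when b) (delay-indicator _ e t c m))
  along-z : ∀ n′ a′ →
    delay (+ 0) e₃ (mono d₁ d₂ d₃ n′ a′) s
    ≡ when (n′ ≡ᵇ d₁) (when (a′ ≡ᵇ d₂) (when (s ≡ᵇ e₃ + d₃) (+ 1)))
  along-z n′ a′ = trans (delay-cong _ e₃ (mono-nested d₁ d₂ d₃ n′ a′) s)
    (trans (delay-if _ (n′ ≡ᵇ d₁) e₃ _ s) (cong (when (n′ ≡ᵇ d₁)) (along (a′ ≡ᵇ d₂) e₃ d₃ (+ 1) s)))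
  along-y : ∀ n′ →
    delay (+ 0) e₂ (λ a′ → when (n′ ≡ᵇ d₁) (when (a′ ≡ᵇ d₂) (when (s ≡ᵇ e₃ + d₃) (+ 1)))) a
    ≡ when (n′ ≡ᵇ d₁) (when (a ≡ᵇ e₂ + d₂) (when (s ≡ᵇ e₃ + d₃) (+ 1)))
  along-y n′ = along (n′ ≡ᵇ d₁) e₂ d₂ _ a

shift-one : ∀ e₁ e₂ e₃ → shift e₁ e₂ e₃ one ≈ mono e₁ e₂ e₃
shift-one e₁ e₂ e₃ =
  ≈-trans (shift-mono e₁ e₂ e₃ 0 0 0) (mono-cong (+-identityʳ e₁) (+-identityʳ e₂) (+-identityʳ e₃))

⊛-cong : ∀ f {g h} → g ≈ h → f ⊛ g ≈ f ⊛ h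
⊛-cong f g≈h n a s = sumℤ0-cong n (λ i → sumℤ0-cong a (λ j → sumℤ0-cong s (λ k →
  cong (f i j k ℤ.*_) (g≈h (n ∸ i) (a ∸ j) (s ∸ k)))))

⊛-distrib : (_∙_ : ℤ → ℤ → ℤ) →
  (∀ m u v → sumℤ0 m (λ i → u i ∙ v i) ≡ sumℤ0 m u ∙ sumℤ0 m v) →
  (∀ x y z → x ℤ.* (y ∙ z) ≡ (x ℤ.* y) ∙ (x ℤ.* z)) →
  ∀ f g h → f ⊛ (λ n a s → g n a s ∙ h n a s) ≈ (λ n a s → (f ⊛ g) n a s ∙ (f ⊛ h) n a s)
⊛-distrib _∙_ sum-∙ *-distrib-∙ f g h n a s =
  trans (sumℤ0-cong n (λ i → trans (sumℤ0-cong a (λ j →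
          trans (sumℤ0-cong s (λ k → *-distrib-∙ (f i j k) _ _)) (sum-∙ s _ _)))
        (sum-∙ a _ _)))
        (sum-∙ n _ _)

⊛-⊕ : ∀ f g h → f ⊛ (g ⊕ h) ≈ (f ⊛ g) ⊕ (f ⊛ h)
⊛-⊕ = ⊛-distrib ℤ._+_ sumℤ0-+ ℤ.*-distribˡ-+

⊛-⊖ : ∀ f g h → f ⊛ (g ⊖ h) ≈ (f ⊛ g) ⊖ (f ⊛ h)
⊛-⊖ = ⊛-distrib ℤ._-_ sumℤ0-- *-distribˡ--
  where
  *-distribˡ-- : ∀ x y z → x ℤ.* (y ℤ.- z) ≡ x ℤ.* y ℤ.- x ℤ.* z
  *-distribˡ-- = ℤ-Solver.solve-∀

⊛-0ₛ : ∀ f → f ⊛ 0ₛ ≈ 0ₛ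
⊛-0ₛ f n a s =
  trans (sumℤ0-cong n (λ i → trans (sumℤ0-cong a (λ j →
          trans (sumℤ0-cong s (λ k → ℤ.*-zeroʳ (f i j k))) (sumℤ0-zero s)))
        (sumℤ0-zero a)))
        (sumℤ0-zero n)

⊛-sumSer : ∀ f m g → f ⊛ sumSer m g ≈ sumSer m (λ i → f ⊛ g i)
⊛-sumSer f zero    g = ⊛-0ₛ f
⊛-sumSer f (suc m) g = ≈-trans (⊛-⊕ f (sumSer m g) (g (suc m))) (⊕-cong (⊛-sumSer f m g) ≈-refl)

⊛-mono : ∀ f e₁ e₂ e₃ → f ⊛ mono e₁ e₂ e₃ ≈ shift e₁ e₂ e₃ f
⊛-mono f e₁ e₂ e₃ n a s =
  trans (sumℤ0-cong n (λ i →
          trans (sumℤ0-cong a (λ j → trans (sumℤ0-cong s (λ k → select i j k)) (sum-z i j)))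
                (sum-y i)))
        (sumℤ0-delta n e₁ _)
  where
  *-when : ∀ x b y → x ℤ.* when b y ≡ when b (x ℤ.* y)
  *-when x true  y = refl
  *-when x false y = ℤ.*-zeroʳ x
  select : ∀ i j k → f i j k ℤ.* mono e₁ e₂ e₃ (n ∸ i) (a ∸ j) (s ∸ k)
    ≡ when (n ∸ i ≡ᵇ e₁) (when (a ∸ j ≡ᵇ e₂) (when (s ∸ k ≡ᵇ e₃) (f i j k)))
  select i j k = begin
    f i j k ℤ.* mono e₁ e₂ e₃ (n ∸ i) (a ∸ j) (s ∸ k)
      ≡⟨ cong (f i j k ℤ.*_) (mono-nested e₁ e₂ e₃ (n ∸ i) (a ∸ j) (s ∸ k)) ⟩
    f i j k ℤ.* when b₁ (when b₂ (when b₃ (+ 1)))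
      ≡⟨ *-when (f i j k) b₁ _ ⟩
    when b₁ (f i j k ℤ.* when b₂ (when b₃ (+ 1)))
      ≡⟨ cong (when b₁) (*-when (f i j k) b₂ _) ⟩
    when b₁ (when b₂ (f i j k ℤ.* when b₃ (+ 1)))
      ≡⟨ cong (when b₁ ∘ when b₂) (trans (*-when (f i j k) b₃ _)
                                         (cong (when b₃) (ℤ.*-identityʳ _))) ⟩
    when b₁ (when b₂ (when b₃ (f i j k))) ∎
    where
    open ≡-Reasoning
    b₁ = n ∸ i ≡ᵇ e₁
    b₂ = a ∸ j ≡ᵇ e₂
    b₃ = s ∸ k ≡ᵇ e₃
  sum-z : ∀ i j →
    sumℤ0 s (λ k → when (n ∸ i ≡ᵇ e₁) (when (a ∸ j ≡ᵇ e₂) (when (s ∸ k ≡ᵇ e₃) (f i j k))))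
    ≡ when (n ∸ i ≡ᵇ e₁) (when (a ∸ j ≡ᵇ e₂) (delay (+ 0) e₃ (f i j) s))
  sum-z i j = trans (sumℤ0-if s (n ∸ i ≡ᵇ e₁) _)
    (cong (when (n ∸ i ≡ᵇ e₁)) (trans (sumℤ0-if s (a ∸ j ≡ᵇ e₂) _)
                                      (cong (when (a ∸ j ≡ᵇ e₂)) (sumℤ0-delta s e₃ (f i j)))))
  sum-y : ∀ i → sumℤ0 a (λ j → when (n ∸ i ≡ᵇ e₁) (when (a ∸ j ≡ᵇ e₂) (delay (+ 0) e₃ (f i j) s)))
    ≡ when (n ∸ i ≡ᵇ e₁) (delay (+ 0) e₂ (λ a′ → delay (+ 0) e₃ (f i a′) s) a)
  sum-y i = trans (sumℤ0-if a (n ∸ i ≡ᵇ e₁) _) (cong (when (n ∸ i ≡ᵇ e₁)) (sumℤ0-delta a e₂ _))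

-- The semi-perimeter of a bargraph

sgn : ℕ → ℕ
sgn zero    = 0
sgn (suc _) = 1

headOr0 : List ℕ → ℕ
headOr0 []      = 0
headOr0 (v ∷ _) = v

-- Half the horizontal boundary counts the nonempty columns, half the vertical
-- boundary is the total descent (including the final drop to the ground).
semiPerimeter : List ℕ → ℕ
semiPerimeter []       = 0
semiPerimeter (u ∷ us) = sgn u + (u ∸ headOr0 us) + semiPerimeter us

uncovered : ℕ → ℕ → ℕ
uncovered j h = b2n (not (j ≤ᵇ h))

sum-uncovered : ∀ b h → sumℕ b (λ j → uncovered j h) ≡ b ∸ h
sum-uncovered zero    h = sym (0∸n≡0 h)
sum-uncovered (suc b) h with b <? h
... | yes b<h rewrite sum-uncovered b h | <ᵇ-true b<h =
  trans (+-identityʳ _) (trans (m≤n⇒m∸n≡0 (<⇒≤ b<h)) (sym (m≤n⇒m∸n≡0 b<h)))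
... | no b≮h rewrite sum-uncovered b h | <ᵇ-false (≮⇒≥ b≮h) =
  trans (+-comm _ 1) (sym (+-∸-assoc 1 (≮⇒≥ b≮h)))

sum-bottom : ∀ b → sumℕ b (λ j → b2n (j ≡ᵇ 1)) ≡ sgn b
sum-bottom zero          = refl
sum-bottom (suc zero)    = refl
sum-bottom (suc (suc b)) = cong (_+ 0) (sum-bottom (suc b))

sum-top : ∀ b → sumℕ b (λ j → uncovered (suc j) b) ≡ sgn b
sum-top zero    = refl
sum-top (suc b) rewrite <ᵇ-false {b} ≤-refl =
  cong (_+ 1) (trans (sumℕ-cong b (λ j _ j≤b → below-top j j≤b)) (sumℕ-zero b))
  where
  below-top : ∀ j → j ≤ b → uncovered (suc j) (suc b) ≡ 0
  below-top j j≤b rewrite <ᵇ-true (s≤s j≤b) = refl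

-- Sides exposed to the left and right neighbours, plus bottom and top.
columnFreeSides : ℕ → ℕ → ℕ → ℕ
columnFreeSides left h right = (h ∸ left) + (h ∸ right) + sgn h + sgn h

isCell-suc : ∀ w i j → isCell w i (suc j) ≡ (suc j ≤ᵇ hgt w i)
isCell-suc w zero    j = refl
isCell-suc w (suc i) j = refl

freeSides-cell : ∀ w i j → suc j ≤ hgt w (suc i) →
  freeSides w (suc i) (suc j)
  ≡ uncovered (suc j) (hgt w i) + uncovered (suc j) (hgt w (suc (suc i)))
    + b2n (suc j ≡ᵇ 1) + uncovered (suc (suc j)) (hgt w (suc i))
freeSides-cell w i j j<h
  rewrite isCell-suc w i j | isCell-suc w (suc (suc i)) j | isCell-suc w (suc i) (suc j) =
  cong (λ t → uncovered (suc j) (hgt w i) + uncovered (suc j) (hgt w (suc (suc i))) + t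
              + uncovered (suc (suc j)) (hgt w (suc i)))
       (bottom j j<h)
  where
  bottom : ∀ k → suc k ≤ hgt w (suc i) → b2n (not (isCell w (suc i) k)) ≡ b2n (suc k ≡ᵇ 1)
  bottom zero    _   = refl
  bottom (suc k) k<h rewrite isCell-suc w (suc i) k | <ᵇ-true (<⇒≤ k<h) = refl

column-freeSides : ∀ w i →
  sumℕ (hgt w (suc i)) (freeSides w (suc i))
  ≡ columnFreeSides (hgt (0 ∷ w) (suc i)) (hgt w (suc i)) (hgt w (suc (suc i)))
column-freeSides w i = begin
  sumℕ h (freeSides w (suc i))
    ≡⟨ sumℕ-cong h (λ { (suc j) _ j<h → freeSides-cell w i j j<h }) ⟩
  sumℕ h (λ j → uncovered j l + uncovered j r + b2n (j ≡ᵇ 1) + uncovered (suc j) h)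
    ≡⟨ trans (sumℕ-+ h _ _)
             (cong₂ _+_ (trans (sumℕ-+ h _ _) (cong₂ _+_ (sumℕ-+ h _ _) refl)) refl) ⟩
  sumℕ h (λ j → uncovered j l) + sumℕ h (λ j → uncovered j r)
    + sumℕ h (λ j → b2n (j ≡ᵇ 1)) + sumℕ h (λ j → uncovered (suc j) h)
    ≡⟨ cong₂ _+_ (cong₂ _+_ (cong₂ _+_ (sum-uncovered h l) (sum-uncovered h r)) (sum-bottom h))
                 (sum-top h) ⟩
  (h ∸ l) + (h ∸ r) + sgn h + sgn h
    ≡⟨ cong (λ t → (h ∸ t) + (h ∸ r) + sgn h + sgn h) (left-neighbour i) ⟩
  columnFreeSides (hgt (0 ∷ w) (suc i)) h r ∎
  where
  open ≡-Reasoning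
  h = hgt w (suc i)
  l = hgt w i
  r = hgt w (suc (suc i))
  left-neighbour : ∀ i → hgt w i ≡ hgt (0 ∷ w) (suc i)
  left-neighbour zero    = refl
  left-neighbour (suc i) = refl

freeSidesFrom : ℕ → List ℕ → ℕ
freeSidesFrom left []       = 0
freeSidesFrom left (u ∷ us) = columnFreeSides left u (headOr0 us) + freeSidesFrom u us

sum-columnFreeSides : ∀ left w →
  sumℕ (len w) (λ i → columnFreeSides (hgt (left ∷ w) i) (hgt w i) (hgt w (suc i)))
  ≡ freeSidesFrom left w
sum-columnFreeSides left []       = refl
sum-columnFreeSides left (u ∷ us) =
  trans (sumℕ-suc (len us) _)
        (cong₂ _+_ (cong (columnFreeSides left u) (hgt-1 us))
                   (trans (sumℕ-cong (len us) (λ { (suc i) _ _ → refl }))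
                          (sum-columnFreeSides u us)))
  where
  hgt-1 : ∀ us → hgt us 1 ≡ headOr0 us
  hgt-1 []      = refl
  hgt-1 (_ ∷ _) = refl

m∸n+n≡n∸m+m : ∀ m n → m ∸ n + n ≡ n ∸ m + m
m∸n+n≡n∸m+m zero    zero    = refl
m∸n+n≡n∸m+m zero    (suc n) = sym (+-identityʳ (suc n))
m∸n+n≡n∸m+m (suc m) zero    = +-identityʳ (suc m)
m∸n+n≡n∸m+m (suc m) (suc n) =
  trans (+-suc (m ∸ n) n) (trans (cong suc (m∸n+n≡n∸m+m m n)) (sym (+-suc (n ∸ m) m)))

-- Total ascent from the left neighbour equals total descent to the ground.
freeSidesFrom-telescope : ∀ left w →
  freeSidesFrom left w + left ≡ semiPerimeter w + semiPerimeter w + (left ∸ headOr0 w)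
freeSidesFrom-telescope left []       = refl
freeSidesFrom-telescope left (u ∷ us) = +-cancelʳ-≡ u _ _ (begin
  (rise + fall + sgn u + sgn u + rest) + left + u
    ≡⟨ regroup rise fall (sgn u) rest left u ⟩
  (rise + left) + (rest + u) + fall + sgn u + sgn u
    ≡⟨ cong₂ (λ x y → x + y + fall + sgn u + sgn u)
             (m∸n+n≡n∸m+m u left) (freeSidesFrom-telescope u us) ⟩
  (left ∸ u + u) + (sp + sp + fall) + fall + sgn u + sgn u
    ≡⟨ collect (left ∸ u) u sp fall (sgn u) ⟩
  (sgn u + fall + sp + (sgn u + fall + sp)) + (left ∸ u) + u ∎)
  where
  open ≡-Reasoning
  rise = u ∸ left
  fall = u ∸ headOr0 us
  rest = freeSidesFrom u us
  sp   = semiPerimeter us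
  regroup : ∀ x y z r l u → (x + y + z + z + r) + l + u ≡ (x + l) + (r + u) + y + z + z
  regroup = solve-∀
  collect : ∀ d u s y z → d + u + (s + s + y) + y + z + z ≡ (z + y + s + (z + y + s)) + d + u
  collect = solve-∀

perimeter≡2*semiPerimeter : ∀ w → perimeter w ≡ semiPerimeter w * 2
perimeter≡2*semiPerimeter w = begin
  perimeter w
    ≡⟨ sumℕ-cong (len w) (λ { (suc i) _ _ → column-freeSides w i }) ⟩
  sumℕ (len w) (λ i → columnFreeSides (hgt (0 ∷ w) i) (hgt w i) (hgt w (suc i)))
    ≡⟨ sum-columnFreeSides 0 w ⟩
  freeSidesFrom 0 w
    ≡⟨ +-identityʳ _ ⟨
  freeSidesFrom 0 w + 0
    ≡⟨ freeSidesFrom-telescope 0 w ⟩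
  semiPerimeter w + semiPerimeter w + (0 ∸ headOr0 w)
    ≡⟨ cong (λ t → semiPerimeter w + semiPerimeter w + t) (0∸n≡0 (headOr0 w)) ⟩
  semiPerimeter w + semiPerimeter w + 0
    ≡⟨ double (semiPerimeter w) ⟩
  semiPerimeter w * 2 ∎
  where
  open ≡-Reasoning
  double : ∀ m → m + m + 0 ≡ m * 2
  double = solve-∀

sper≡semiPerimeter : ∀ w → sper w ≡ semiPerimeter w
sper≡semiPerimeter w =
  trans (cong (_/ 2) (perimeter≡2*semiPerimeter w)) (m*n/n≡m (semiPerimeter w) 2)

sum-letters-suc : ∀ p f → sum (map f (letters (suc p))) ≡ sum (map f (letters p)) + f (suc p)
sum-letters-suc p f = begin
  sum (map f (map suc (upTo (suc p))))
    ≡⟨ cong (sum ∘ map f ∘ map suc) (upTo-∷ʳ p) ⟨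
  sum (map f (map suc (upTo p ∷ʳ p)))
    ≡⟨ cong (sum ∘ map f) (map-++ suc (upTo p) _) ⟩
  sum (map f (letters p ++ suc p ∷ []))
    ≡⟨ cong sum (map-++ f (letters p) _) ⟩
  sum (map f (letters p) ++ f (suc p) ∷ [])
    ≡⟨ sum-++ (map f (letters p)) _ ⟩
  sum (map f (letters p)) + (f (suc p) + 0)
    ≡⟨ cong (λ t → sum (map f (letters p)) + t) (+-identityʳ _) ⟩
  sum (map f (letters p)) + f (suc p) ∎
  where open ≡-Reasoning

sum-letters-miss : ∀ p t (X : ℕ → ℕ) → p < t →
  sum (map (λ c → if c ≡ᵇ t then X c else 0) (letters p)) ≡ 0
sum-letters-miss zero    t X _   = refl
sum-letters-miss (suc p) t X p<t =
  trans (sum-letters-suc p _)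
        (cong₂ _+_ (sum-letters-miss p t X (<-trans (n<1+n p) p<t))
                   (cong (λ b → if b then X (suc p) else 0) (≡ᵇ-false (<⇒≢ p<t))))

sum-letters-pick : ∀ p t (X : ℕ → ℕ) → 1 ≤ t → t ≤ p →
  sum (map (λ c → if c ≡ᵇ t then X c else 0) (letters p)) ≡ X t
sum-letters-pick zero    t X 1≤t t≤0 = ⊥-elim (<⇒≱ 1≤t t≤0)
sum-letters-pick (suc p) t X 1≤t t≤1+p =
  trans (sum-letters-suc p _) (last-or-earlier (m≤n⇒m<n∨m≡n t≤1+p))
  where
  last-or-earlier : t < suc p ⊎ t ≡ suc p →
    sum (map (λ c → if c ≡ᵇ t then X c else 0) (letters p))
      + (if suc p ≡ᵇ t then X (suc p) else 0) ≡ X t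
  last-or-earlier (inj₁ t<1+p) rewrite ≡ᵇ-false (>⇒≢ t<1+p) =
    trans (+-identityʳ _) (sum-letters-pick p t X 1≤t (≤-pred t<1+p))
  last-or-earlier (inj₂ refl) rewrite ≡ᵇ-refl t =
    cong (_+ X t) (sum-letters-miss p t X ≤-refl)

count-cong : ∀ {P Q : List ℕ → Bool} → (∀ w → P w ≡ Q w) → ∀ L → count P L ≡ count Q L
count-cong P≡Q []      = refl
count-cong P≡Q (w ∷ L) = cong₂ _+_ (cong b2n (P≡Q w)) (count-cong P≡Q L)

count-false : ∀ L → count (λ _ → false) L ≡ 0
count-false []      = refl
count-false (w ∷ L) = count-false L

count-∧ : ∀ b Q L → count (λ w → b ∧ Q w) L ≡ (if b then count Q L else 0)
count-∧ true  Q L = refl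
count-∧ false Q L = count-false L

count-++ : ∀ P xs ys → count P (xs ++ ys) ≡ count P xs + count P ys
count-++ P []       ys = refl
count-++ P (x ∷ xs) ys =
  trans (cong (λ t → b2n (P x) + t) (count-++ P xs ys)) (sym (+-assoc (b2n (P x)) _ _))

count-prepend : ∀ P cs L →
  count P (concatMap (λ w → map (λ c → c ∷ w) cs) L)
  ≡ sum (map (λ c → count (λ w → P (c ∷ w)) L) cs)
count-prepend P cs []      = sym (sum-map-zero cs)
count-prepend P cs (w ∷ L) = begin
  count P (map (λ c → c ∷ w) cs ++ concatMap (λ w → map (λ c → c ∷ w) cs) L)
    ≡⟨ count-++ P (map (λ c → c ∷ w) cs) _ ⟩
  count P (map (λ c → c ∷ w) cs) + count P (concatMap (λ w → map (λ c → c ∷ w) cs) L)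
    ≡⟨ cong₂ _+_ (one-word cs) (count-prepend P cs L) ⟩
  sum (map (λ c → b2n (P (c ∷ w))) cs) + sum (map (λ c → count (λ w → P (c ∷ w)) L) cs)
    ≡⟨ sum-map-+ (λ c → b2n (P (c ∷ w))) _ cs ⟨
  sum (map (λ c → count (λ w → P (c ∷ w)) (w ∷ L)) cs) ∎
  where
  open ≡-Reasoning
  one-word : ∀ cs → count P (map (λ c → c ∷ w) cs) ≡ sum (map (λ c → b2n (P (c ∷ w))) cs)
  one-word []       = refl
  one-word (c ∷ cs) = cong (λ t → b2n (P (c ∷ w)) + t) (one-word cs)

count-allWords-suc : ∀ p n P →
  count P (allWords p (suc n))
  ≡ sum (map (λ c → count (λ w → P (c ∷ w)) (allWords p n)) (letters p))
count-allWords-suc p n P = count-prepend P (letters p) (allWords p n)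

count-delay : ∀ (H : List ℕ → Bool → Bool) → (∀ w → H w false ≡ false) →
  ∀ e (x : List ℕ → ℕ) L a →
  count (λ w → H w (e + x w ≡ᵇ a)) L ≡ delay 0 e (λ a′ → count (λ w → H w (x w ≡ᵇ a′)) L) a
count-delay H H-false zero    x L a       = refl
count-delay H H-false (suc e) x L zero    = trans (count-cong H-false L) (count-false L)
count-delay H H-false (suc e) x L (suc a) = count-delay H H-false e x L a

-- Words c w with w ∈ {1,…,p}ⁿ obeying the transition rule; c itself need not be p.
startCount : ℕ → ℕ → ℕ → ℕ → ℕ → ℕ
startCount p c n a s =
  count (λ w → validSteps p (c ∷ w) ∧ (area (c ∷ w) ≡ᵇ a) ∧ (semiPerimeter (c ∷ w) ≡ᵇ s))
        (allWords p n)

Fcoef-suc : ∀ p → 1 ≤ p → ∀ n a s → Fcoef p (suc n) a s ≡ startCount p p n a s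
Fcoef-suc p 1≤p n a s = begin
  Fcoef p (suc n) a s
    ≡⟨ count-cong (λ w → cong (λ t → isPFib p w ∧ (area w ≡ᵇ a) ∧ (t ≡ᵇ s)) (sper≡semiPerimeter w))
                  (allWords p (suc n)) ⟩
  count (λ w → isPFib p w ∧ (area w ≡ᵇ a) ∧ (semiPerimeter w ≡ᵇ s)) (allWords p (suc n))
    ≡⟨ count-allWords-suc p n _ ⟩
  sum (map (λ c → count (λ w → ((c ≡ᵇ p) ∧ validSteps p (c ∷ w)) ∧ (area (c ∷ w) ≡ᵇ a)
                                 ∧ (semiPerimeter (c ∷ w) ≡ᵇ s)) (allWords p n)) (letters p))
    ≡⟨ cong sum (map-cong (λ c → trans (count-cong (λ w → ∧-assoc (c ≡ᵇ p) _ _) (allWords p n))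
                                       (count-∧ (c ≡ᵇ p) (R c) (allWords p n))) (letters p)) ⟩
  sum (map (λ c → if c ≡ᵇ p then startCount p c n a s else 0) (letters p))
    ≡⟨ sum-letters-pick p p (λ c → startCount p c n a s) 1≤p ≤-refl ⟩
  startCount p p n a s ∎
  where
  open ≡-Reasoning
  R = λ c w → validSteps p (c ∷ w) ∧ (area (c ∷ w) ≡ᵇ a) ∧ (semiPerimeter (c ∷ w) ≡ᵇ s)

startCount-suc : ∀ p c n a s → startCount p c (suc n) a s ≡
  sum (map (λ d → if step p c d
                  then delay 0 c (λ a′ → delay 0 (sgn c + (c ∸ d)) (startCount p d n a′) s) a
                  else 0) (letters p))
startCount-suc p c n a s =
  trans (count-allWords-suc p n _) (cong sum (map-cong next-letter (letters p)))
  where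
  L = allWords p n
  next-letter : ∀ d →
    count (λ w → validSteps p (c ∷ d ∷ w) ∧ (area (c ∷ d ∷ w) ≡ᵇ a)
                 ∧ (semiPerimeter (c ∷ d ∷ w) ≡ᵇ s)) L
    ≡ (if step p c d
       then delay 0 c (λ a′ → delay 0 (sgn c + (c ∸ d)) (startCount p d n a′) s) a
       else 0)
  next-letter d = begin
    count (λ w → (step p c d ∧ V w) ∧ (c + area (d ∷ w) ≡ᵇ a) ∧ (K + semiPerimeter (d ∷ w) ≡ᵇ s)) L
      ≡⟨ count-cong (λ w → ∧-assoc (step p c d) _ _) L ⟩
    count (λ w → step p c d ∧ V w ∧ (c + area (d ∷ w) ≡ᵇ a) ∧ (K + semiPerimeter (d ∷ w) ≡ᵇ s)) L
      ≡⟨ count-∧ (step p c d) _ L ⟩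
    (if step p c d
     then count (λ w → V w ∧ (c + area (d ∷ w) ≡ᵇ a) ∧ (K + semiPerimeter (d ∷ w) ≡ᵇ s)) L
     else 0)
      ≡⟨ cong (λ t → if step p c d then t else 0) (trans
           (count-delay (λ w b → V w ∧ b ∧ (K + semiPerimeter (d ∷ w) ≡ᵇ s)) (λ w → ∧-zeroʳ (V w))
                        c (area ∘ (d ∷_)) L a)
           (delay-cong 0 c (λ a′ →
              count-delay (λ w b → V w ∧ (area (d ∷ w) ≡ᵇ a′) ∧ b)
                          (λ w → trans (cong (V w ∧_) (∧-zeroʳ _)) (∧-zeroʳ (V w)))
                          K (semiPerimeter ∘ (d ∷_)) L s) a)) ⟩
    (if step p c d then delay 0 c (λ a′ → delay 0 K (startCount p d n a′) s) a else 0) ∎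
    where
    open ≡-Reasoning
    V = λ w → validSteps p (d ∷ w)
    K = sgn c + (c ∸ d)

G : ℕ → ℕ → Ser
G p c zero    a s = + 0
G p c (suc n) a s = + startCount p c n a s

F≈one⊕G : ∀ p → 1 ≤ p → F p ≈ one ⊕ G p p
F≈one⊕G p 1≤p zero    zero    zero    = refl
F≈one⊕G p 1≤p zero    zero    (suc s) = refl
F≈one⊕G p 1≤p zero    (suc a) s       = refl
F≈one⊕G p 1≤p (suc n) a       s       = cong +_ (Fcoef-suc p 1≤p n a s)

G-x¹ : ∀ p c a s → G p (suc c) 1 a s ≡ mono 1 (suc c) (suc (suc c)) 1 a s
G-x¹ p c a s rewrite +-identityʳ c | ≡ᵇ-sym (suc c) a | ≡ᵇ-sym (suc (suc c)) s =
  indicator ((a ≡ᵇ suc c) ∧ (s ≡ᵇ suc (suc c)))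
  where
  indicator : ∀ b → + (b2n b + 0) ≡ (if b then + 1 else + 0)
  indicator true  = refl
  indicator false = refl

shift-G-at-x¹ : ∀ p d e₂ e₃ a s → shift 1 e₂ e₃ (G p d) 1 a s ≡ + 0
shift-G-at-x¹ p d e₂ e₃ a s = shift-0ₛ 0 e₂ e₃ 0 a s

shift-G-at-x² : ∀ p c d n a s {K} → sgn c + (c ∸ d) ≡ K →
  + delay 0 c (λ a′ → delay 0 (sgn c + (c ∸ d)) (startCount p d n a′) s) a
  ≡ shift 1 c K (G p d) (suc (suc n)) a s
shift-G-at-x² p c d n a s refl =
  trans (delay-map +_ refl c _ a)
        (delay-cong (+ 0) c (λ a′ → delay-map +_ refl (sgn c + (c ∸ d)) (startCount p d n a′) s) a)

G-one-rec : ∀ p → 1 ≤ p → G p 1 ≈ mono 1 1 2 ⊕ shift 1 1 1 (G p p)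
G-one-rec p 1≤p zero          a s = refl
G-one-rec p 1≤p (suc zero)    a s =
  trans (G-x¹ p 0 a s)
        (sym (trans (cong (λ t → mono 1 1 2 1 a s ℤ.+ t) (shift-G-at-x¹ p p 1 1 a s))
                    (ℤ.+-identityʳ _)))
G-one-rec p 1≤p (suc (suc n)) a s = begin
  + startCount p 1 (suc n) a s
    ≡⟨ cong +_ (trans (startCount-suc p 1 n a s) (sum-letters-pick p p _ 1≤p ≤-refl)) ⟩
  + delay 0 1 (λ a′ → delay 0 (1 + (1 ∸ p)) (startCount p p n a′) s) a
    ≡⟨ shift-G-at-x² p 1 p n a s (cong suc (m≤n⇒m∸n≡0 1≤p)) ⟩
  shift 1 1 1 (G p p) (suc (suc n)) a s
    ≡⟨ ℤ.+-identityˡ _ ⟨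
  (mono 1 1 2 ⊕ shift 1 1 1 (G p p)) (suc (suc n)) a s ∎
  where open ≡-Reasoning

G-suc-rec : ∀ p c → suc (suc c) ≤ p →
  G p (suc (suc c))
  ≈ (mono 1 (suc (suc c)) (suc (suc (suc c))) ⊕ shift 1 (suc (suc c)) 2 (G p (suc c)))
    ⊕ shift 1 (suc (suc c)) 1 (G p p)
G-suc-rec p c C≤p zero          a s = refl
G-suc-rec p c C≤p (suc zero)    a s =
  trans (G-x¹ p (suc c) a s)
        (sym (trans (cong₂ (λ u v → mono 1 (suc (suc c)) (suc (suc (suc c))) 1 a s ℤ.+ u ℤ.+ v)
                           (shift-G-at-x¹ p (suc c) (suc (suc c)) 2 a s)
                           (shift-G-at-x¹ p p (suc (suc c)) 1 a s))
                    (trans (ℤ.+-identityʳ _) (ℤ.+-identityʳ _))))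
G-suc-rec p c C≤p (suc (suc n)) a s = begin
  + startCount p C (suc n) a s
    ≡⟨ cong +_ (startCount-suc p C n a s) ⟩
  + sum (map (λ d → if (d ≡ᵇ suc c) ∨ (d ≡ᵇ p) then via d else 0) (letters p))
    ≡⟨ cong (+_ ∘ sum) (map-cong split (letters p)) ⟩
  + sum (map (λ d → (if d ≡ᵇ suc c then via d else 0) + (if d ≡ᵇ p then via d else 0)) (letters p))
    ≡⟨ cong +_ (trans (sum-map-+ _ _ (letters p))
                      (cong₂ _+_ (sum-letters-pick p (suc c) via (s≤s z≤n) (<⇒≤ C≤p))
                                 (sum-letters-pick p p via (≤-trans (s≤s z≤n) C≤p) ≤-refl))) ⟩
  + (via (suc c) + via p)
    ≡⟨ ℤ.pos-+ (via (suc c)) (via p) ⟩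
  + via (suc c) ℤ.+ + via p
    ≡⟨ cong₂ ℤ._+_ (trans (shift-G-at-x² p C (suc c) n a s (cong suc (m+n∸n≡m 1 c)))
                          (sym (ℤ.+-identityˡ _)))
                   (shift-G-at-x² p C p n a s (cong suc (m≤n⇒m∸n≡0 C≤p))) ⟩
  ((mono 1 C (suc C) ⊕ shift 1 C 2 (G p (suc c))) ⊕ shift 1 C 1 (G p p)) (suc (suc n)) a s ∎
  where
  open ≡-Reasoning
  C = suc (suc c)
  via : ℕ → ℕ
  via d = delay 0 C (λ a′ → delay 0 (sgn C + (C ∸ d)) (startCount p d n a′) s) a
  split : ∀ d → (if (d ≡ᵇ suc c) ∨ (d ≡ᵇ p) then via d else 0)
              ≡ (if d ≡ᵇ suc c then via d else 0) + (if d ≡ᵇ p then via d else 0)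
  split d with d ≟ suc c
  ... | yes refl rewrite ≡ᵇ-refl (suc c) | ≡ᵇ-false (<⇒≢ C≤p) = sym (+-identityʳ (via (suc c)))
  ... | no d≢1+c rewrite ≡ᵇ-false d≢1+c = refl

-- Unrolling the descending runs

staircase : ℕ → ℕ → ℕ
staircase c i = sumℕ (c ∸ i) (λ k → i + k)

staircase-suc : ∀ {c i} → i ≤ c → staircase (suc c) i ≡ suc c + staircase c i
staircase-suc {c} {i} i≤c = begin
  sumℕ (suc c ∸ i) (λ k → i + k)
    ≡⟨ cong (λ m → sumℕ m (λ k → i + k)) (+-∸-assoc 1 i≤c) ⟩
  staircase c i + (i + suc (c ∸ i))
    ≡⟨ cong (λ t → staircase c i + t) (trans (+-suc i (c ∸ i)) (cong suc (m+[n∸m]≡n i≤c))) ⟩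
  staircase c i + suc c
    ≡⟨ +-comm (staircase c i) (suc c) ⟩
  suc c + staircase c i ∎
  where open ≡-Reasoning

staircase-self : ∀ c → staircase c c ≡ 0
staircase-self c = cong (λ m → sumℕ m (λ k → c + k)) (n∸n≡0 c)

-- Words starting with c that run down c, c − 1, …, i (each of the c − i columns
-- above i adding 1 to the width and 1 to the drop), then stop or jump back to p.
block : ℕ → ℕ → ℕ → Ser
block p c i = shift (c ∸ i) (staircase c i) (2 * (c ∸ i)) (mono 1 i (suc i) ⊕ shift 1 i 1 (G p p))

block-self : ∀ p c → block p c c ≈ mono 1 c (suc c) ⊕ shift 1 c 1 (G p p)
block-self p c = shift-exponents _ (n∸n≡0 c) (staircase-self c) (cong (2 *_) (n∸n≡0 c))

block-extend : ∀ p c i → i ≤ c → shift 1 (suc c) 2 (block p c i) ≈ block p (suc c) i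
block-extend p c i i≤c =
  ≈-trans (shift-shift 1 (suc c) 2 _ _ _ _)
          (shift-exponents _ (sym (+-∸-assoc 1 i≤c)) (sym (staircase-suc i≤c))
                             (trans (sym (*-suc 2 (c ∸ i))) (cong (2 *_) (sym (+-∸-assoc 1 i≤c)))))

G≈sum-blocks : ∀ p c → 1 ≤ c → c ≤ p → G p c ≈ sumSer c (block p c)
G≈sum-blocks p (suc zero)    _ 1≤p n a s = trans (G-one-rec p 1≤p n a s) (sym (ℤ.+-identityˡ _))
G≈sum-blocks p (suc (suc c)) _ C≤p =
  ≈-trans (G-suc-rec p c C≤p)
          (≈-trans (⊕-rotate (mono 1 C (suc C)) (shift 1 C 2 (G p (suc c))) (shift 1 C 1 (G p p)))
                   (⊕-cong (extend-runs (G≈sum-blocks p (suc c) (s≤s z≤n) (<⇒≤ C≤p)))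
                           (≈-sym (block-self p C))))
  where
  open ≈-Reasoning
  C = suc (suc c)
  extend-runs : G p (suc c) ≈ sumSer (suc c) (block p (suc c)) →
                shift 1 C 2 (G p (suc c)) ≈ sumSer (suc c) (block p C)
  extend-runs G≈blocks = begin
    shift 1 C 2 (G p (suc c))
      ≈⟨ shift-cong 1 C 2 G≈blocks ⟩
    shift 1 C 2 (sumSer (suc c) (block p (suc c)))
      ≈⟨ shift-sumSer 1 C 2 (suc c) (block p (suc c)) ⟩
    sumSer (suc c) (shift 1 C 2 ∘ block p (suc c))
      ≈⟨ sumSer-cong (suc c) (λ i _ i≤1+c → block-extend p (suc c) i i≤1+c) ⟩
    sumSer (suc c) (block p C) ∎

by-difference : ∀ {i} (P : ℕ → Set) → (∀ k → P (i + k)) → ∀ {p} → i ≤ p → P p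
by-difference P P[i+k] i≤p = subst P (m+[n∸m]≡n i≤p) (P[i+k] _)

staircase+i≡ex : ∀ {p i} → i ≤ p → staircase p i + i ≡ ex p i
staircase+i≡ex {p} {i} = by-difference (λ p → staircase p i + i ≡ ex p i) on-i+k
  where
  base : ∀ i → (0 + i) * 2 ≡ (i + 0 + i) * (0 + 1)
  base = solve-∀
  expand : ∀ S i k → (S + (i + suc k) + i) * 2 ≡ (S + i) * 2 + (i + suc k) * 2
  expand = solve-∀
  collect : ∀ i k → (i + k + i) * (k + 1) + (i + suc k) * 2 ≡ (i + suc k + i) * (suc k + 1)
  collect = solve-∀
  gauss : ∀ k → (sumℕ k (λ j → i + j) + i) * 2 ≡ (i + k + i) * (k + 1)
  gauss zero    = base i
  gauss (suc k) = trans (expand (sumℕ k (λ j → i + j)) i k)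
                        (trans (cong (λ t → t + (i + suc k) * 2) (gauss k)) (collect i k))
  on-i+k : ∀ k → staircase (i + k) i + i ≡ ex (i + k) i
  on-i+k k rewrite m+n∸m≡n i k = sym (trans (cong (_/ 2) (sym (gauss k))) (m*n/n≡m _ 2))

2[p∸i]+1+i≡2p∸i+1 : ∀ {p i} → i ≤ p → 2 * (p ∸ i) + suc i ≡ 2 * p ∸ i + 1
2[p∸i]+1+i≡2p∸i+1 {p} {i} = by-difference (λ p → 2 * (p ∸ i) + suc i ≡ 2 * p ∸ i + 1) on-i+k
  where
  twice : ∀ i k → 2 * (i + k) ≡ i + (i + 2 * k)
  twice = solve-∀
  reorder : ∀ i k → 2 * k + suc i ≡ i + 2 * k + 1
  reorder = solve-∀
  on-i+k : ∀ k → 2 * (i + k ∸ i) + suc i ≡ 2 * (i + k) ∸ i + 1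
  on-i+k k = begin
    2 * (i + k ∸ i) + suc i   ≡⟨ cong (λ t → 2 * t + suc i) (m+n∸m≡n i k) ⟩
    2 * k + suc i             ≡⟨ reorder i k ⟩
    i + 2 * k + 1             ≡⟨ cong (_+ 1) (m+n∸m≡n i (i + 2 * k)) ⟨
    i + (i + 2 * k) ∸ i + 1   ≡⟨ cong (λ t → t ∸ i + 1) (twice i k) ⟨
    2 * (i + k) ∸ i + 1       ∎
    where open ≡-Reasoning

numTerm denomTerm : ℕ → ℕ → Ser
numTerm   p i = mono (p ∸ i + 1) (ex p i) (2 * p ∸ i + 1)
denomTerm p i = mono (p ∸ i + 1) (ex p i) (2 * p ∸ 2 * i + 1)

denomShift : ℕ → ℕ → Ser → Ser
denomShift p i = shift (p ∸ i + 1) (ex p i) (2 * p ∸ 2 * i + 1)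

block-top : ∀ p i → i ≤ p → block p p i ≈ numTerm p i ⊕ denomShift p i (G p p)
block-top p i i≤p =
  ≈-trans (shift-⊕ (p ∸ i) (staircase p i) (2 * (p ∸ i)) _ _)
          (⊕-cong (≈-trans (shift-mono (p ∸ i) (staircase p i) (2 * (p ∸ i)) 1 i (suc i))
                           (mono-cong {p ∸ i + 1} refl y-exponent (2[p∸i]+1+i≡2p∸i+1 i≤p)))
                  (≈-trans (shift-shift (p ∸ i) (staircase p i) (2 * (p ∸ i)) 1 i 1 (G p p))
                           (shift-exponents {p ∸ i + 1} (G p p) refl y-exponent
                                            (cong (_+ 1) (*-distribˡ-∸ 2 p i)))))
  where
  y-exponent : staircase p i + i ≡ ex p i
  y-exponent = staircase+i≡ex i≤p

denomTerm-top : ∀ p → denomTerm p p ≈ mono 1 p 1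
denomTerm-top p =
  mono-cong (cong (_+ 1) (n∸n≡0 p))
            (trans (sym (staircase+i≡ex {p} ≤-refl)) (cong (_+ p) (staircase-self p)))
            (cong (_+ 1) (n∸n≡0 (2 * p)))

Den≈one⊖sum-denomTerm : ∀ p → 1 ≤ p → Den p ≈ one ⊖ sumSer p (denomTerm p)
Den≈one⊖sum-denomTerm (suc p) _ n a s =
  trans (regroup (one n a s) (mono 1 (suc p) 1 n a s) (sumSer p (denomTerm (suc p)) n a s))
        (cong (λ t → one n a s ℤ.- (sumSer p (denomTerm (suc p)) n a s ℤ.+ t))
              (sym (denomTerm-top (suc p) n a s)))
  where
  regroup : ∀ o m S → (o ℤ.- m) ℤ.- S ≡ o ℤ.- (S ℤ.+ m)
  regroup = ℤ-Solver.solve-∀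

G≈Num⊕ : ∀ p → 1 ≤ p → G p p ≈ Num p ⊕ sumSer p (λ i → denomShift p i (G p p))
G≈Num⊕ p 1≤p = ≈-trans (G≈sum-blocks p p 1≤p ≤-refl)
  (≈-trans (sumSer-cong p (λ i _ i≤p → block-top p i i≤p)) (sumSer-⊕ p (numTerm p) _))

F⊛sum-denomTerm : ∀ p → 1 ≤ p →
  F p ⊛ sumSer p (denomTerm p) ≈ sumSer p (denomTerm p) ⊕ sumSer p (λ i → denomShift p i (G p p))
F⊛sum-denomTerm p 1≤p = ≈-trans (⊛-sumSer (F p) p (denomTerm p))
  (≈-trans (sumSer-cong p (λ i _ _ → term i)) (sumSer-⊕ p (denomTerm p) _))
  where
  term : ∀ i → F p ⊛ denomTerm p i ≈ denomTerm p i ⊕ denomShift p i (G p p)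
  term i = begin
    F p ⊛ denomTerm p i                         ≈⟨ ⊛-mono (F p) e₁ e₂ e₃ ⟩
    denomShift p i (F p)                        ≈⟨ shift-cong e₁ e₂ e₃ (F≈one⊕G p 1≤p) ⟩
    denomShift p i (one ⊕ G p p)                ≈⟨ shift-⊕ e₁ e₂ e₃ one (G p p) ⟩
    denomShift p i one ⊕ denomShift p i (G p p) ≈⟨ ⊕-cong (shift-one e₁ e₂ e₃) ≈-refl ⟩
    denomTerm p i ⊕ denomShift p i (G p p)      ∎
    where
    open ≈-Reasoning
    e₁ = p ∸ i + 1
    e₂ = ex p i
    e₃ = 2 * p ∸ 2 * i + 1

theorem1 : (p : ℕ) → 1 ≤ p → (n a s : ℕ) →
    (F p ⊛ Den p) n a s ≡ (Den p ⊕ Num p) n a s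
theorem1 p 1≤p n a s = begin
  (F p ⊛ Den p) n a s
    ≡⟨ ⊛-cong (F p) (Den≈one⊖sum-denomTerm p 1≤p) n a s ⟩
  (F p ⊛ (one ⊖ D)) n a s
    ≡⟨ ⊛-⊖ (F p) one D n a s ⟩
  (F p ⊛ one) n a s ℤ.- (F p ⊛ D) n a s
    ≡⟨ cong₂ ℤ._-_ (trans (⊛-mono (F p) 0 0 0 n a s) (F≈one⊕G p 1≤p n a s))
                   (F⊛sum-denomTerm p 1≤p n a s) ⟩
  one n a s ℤ.+ G p p n a s ℤ.- (D n a s ℤ.+ S n a s)
    ≡⟨ cong (λ t → one n a s ℤ.+ t ℤ.- (D n a s ℤ.+ S n a s)) (G≈Num⊕ p 1≤p n a s) ⟩
  one n a s ℤ.+ (Num p n a s ℤ.+ S n a s) ℤ.- (D n a s ℤ.+ S n a s)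
    ≡⟨ cancel (one n a s) (Num p n a s) (S n a s) (D n a s) ⟩
  (one n a s ℤ.- D n a s) ℤ.+ Num p n a s
    ≡⟨ cong (ℤ._+ Num p n a s) (Den≈one⊖sum-denomTerm p 1≤p n a s) ⟨
  (Den p ⊕ Num p) n a s ∎
  where
  open ≡-Reasoning
  D = sumSer p (denomTerm p)
  S = sumSer p (λ i → denomShift p i (G p p))
  cancel : ∀ o N S D → o ℤ.+ (N ℤ.+ S) ℤ.- (D ℤ.+ S) ≡ (o ℤ.- D) ℤ.+ N
  cancel = ℤ-Solver.solve-∀
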